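{- For every $\pi\in S_n$, $\overline{\pi^{ -1}}=\pi^{ -1}\circ\overline{\pi}^{ -1}\circ\pi$, i.e. $\overline{\pi^{ -1}}=(\overline{\pi}^{ -1})^{(\pi^{ -1})}$.
   Context: Permutations are composed right to left; $\pi\in S_n$ is written $\langle \pi_1\ \cdots\ \pi_n\rangle$, $\pi_i=\pi(i)$, and identified with the permutation of $\{0,\ldots,n\}$ fixing $0$. $\overline{\pi}=(0,1,2,\ldots,n)\circ(0,\pi_n,\pi_{n-1},\ldots,\pi_1)$, a permutation of $\{0,\ldots,n\}$. For permutations $\alpha,\beta$, $\alpha^\beta=\beta\circ\alpha\circ\beta^{ -1}$. -}

module Defs where

open import Data.Nat as ℕ using (ℕ; suc)
open import Data.Nat.Properties as ℕP using ()
open import Data.Fin using (Fin; zero; suc; toℕ; fromℕ; inject₁; lower₁)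
open import Data.Fin.Properties using (toℕ-fromℕ; toℕ-inject₁; inject₁-lower₁; lower₁-inject₁′)
open import Data.Fin.Permutation
  using (Permutation′; permutation; _⟨$⟩ʳ_; _⟨$⟩ˡ_; _∘ₚ_; flip; lift₀)
open import Relation.Binary.PropositionalEquality
open import Relation.Nullary using (yes; no)

-- S_n is 'Permutation′ n' (bijections of Fin n, where the
-- element k of Fin n stands for the point k+1 of {1,…,n}).  Permutations
-- of {0,…,n} are 'Permutation′ (suc n)'; the point 0 is 'zero'.
-- 'lift₀ π' is π viewed as a permutation of {0,…,n} fixing 0.

-- Composition written right to left, as in the paper: (α ⊙ β) x = α (β x).
infixr 9 _⊙_
_⊙_ : ∀ {n} → Permutation′ n → Permutation′ n → Permutation′ n
α ⊙ β = β ∘ₚ α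

_⁻¹ : ∀ {n} → Permutation′ n → Permutation′ n
π ⁻¹ = flip π

-- The (n+1)-cycle (0,1,2,…,n) on {0,…,n}: k ↦ k+1 for k < n, n ↦ 0.
cyc-to : ∀ {n} → Fin (suc n) → Fin (suc n)
cyc-to {n} i with n ℕP.≟ toℕ i
... | yes _ = zero
... | no ne = suc (lower₁ i ne)

cyc-from : ∀ {n} → Fin (suc n) → Fin (suc n)
cyc-from {n} zero = fromℕ n
cyc-from (suc j) = inject₁ j

cyc-from-to : ∀ {n} (i : Fin (suc n)) → cyc-from (cyc-to i) ≡ i
cyc-from-to {n} i with n ℕP.≟ toℕ i
... | yes eq = Data.Fin.Properties.toℕ-injective (trans (toℕ-fromℕ n) eq)
  where import Data.Fin.Properties
... | no ne = inject₁-lower₁ i ne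

cyc-to-from : ∀ {n} (i : Fin (suc n)) → cyc-to (cyc-from i) ≡ i
cyc-to-from {n} zero with n ℕP.≟ toℕ (fromℕ n)
... | yes _ = refl
... | no ne = ⊥-elim′ (ne (sym (toℕ-fromℕ n)))
  where
  open import Data.Empty renaming (⊥-elim to ⊥-elim′)
cyc-to-from {n} (suc j) with n ℕP.≟ toℕ (inject₁ j)
... | yes eq = ⊥-elim′ (ℕP.<-irrefl (sym (trans eq (toℕ-inject₁ j))) (Data.Fin.Properties.toℕ<n j))
  where
  open import Data.Empty renaming (⊥-elim to ⊥-elim′)
  import Data.Fin.Properties
... | no ne = cong suc (lower₁-inject₁′ j ne)

cycle0n : ∀ {n} → Permutation′ (suc n)
cycle0n = permutation cyc-to cyc-from cyc-to-from cyc-from-to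

-- The cycle (0, π_n, π_{n-1}, …, π_1) on {0,…,n}, for π ∈ S_n:
-- 0 ↦ π_n, π_j ↦ π_{j-1} (2 ≤ j ≤ n), π_1 ↦ 0.  Pointwise, x ↦ π̂ (c⁻¹ (π̂⁻¹ x))
-- with π̂ = lift₀ π and c = (0,1,…,n), which is exactly this cycle.
revCycle : ∀ {n} → Permutation′ n → Permutation′ (suc n)
revCycle π = lift₀ π ⊙ (cycle0n ⁻¹) ⊙ (lift₀ π ⁻¹)

bar : ∀ {n} → Permutation′ n → Permutation′ (suc n)
bar π = cycle0n ⊙ revCycle π

-- Write π̂ = lift₀ π and c = (0,1,…,n), so that π̄ = c π̂ c⁻¹ π̂⁻¹ is a commutator.
-- Conjugating the inverse commutator π̂ c π̂⁻¹ c⁻¹ by π̂ gives c π̂⁻¹ c⁻¹ π̂ in any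
-- group, and this is the bar of π⁻¹ because lifting commutes with inversion.
module Submission where

open import Defs
open import Data.Nat as ℕ using (ℕ)
open import Data.Fin using (zero; suc)
open import Data.Fin.Permutation
  using (Permutation′; lift₀; _≈_; _⟨$⟩ʳ_; _⟨$⟩ˡ_; inverseˡ)
open import Relation.Binary.PropositionalEquality using (_≡_; refl; sym; cong; module ≡-Reasoning)

lift₀-⁻¹ : ∀ {n} (π : Permutation′ n) → lift₀ (π ⁻¹) ≈ lift₀ π ⁻¹
lift₀-⁻¹ π zero    = refl
lift₀-⁻¹ π (suc i) = refl

conjugate-commutator-⁻¹ : ∀ {n} (c p : Permutation′ n) →
  p ⁻¹ ⊙ (c ⊙ p ⊙ c ⁻¹ ⊙ p ⁻¹) ⁻¹ ⊙ p ≈ c ⊙ p ⁻¹ ⊙ c ⁻¹ ⊙ p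
conjugate-commutator-⁻¹ c p x = inverseˡ p

lemma9 : (n : ℕ) (π : Permutation′ n) →
    bar (π ⁻¹) ≈ (lift₀ π ⁻¹) ⊙ (bar π ⁻¹) ⊙ lift₀ π
lemma9 n π x = begin
  bar (π ⁻¹) ⟨$⟩ʳ x
    ≡⟨ cong (λ y → c ⟨$⟩ʳ (lift₀ (π ⁻¹) ⟨$⟩ʳ (c ⟨$⟩ˡ y))) (sym (lift₀-⁻¹ (π ⁻¹) x)) ⟩
  c ⟨$⟩ʳ (lift₀ (π ⁻¹) ⟨$⟩ʳ (c ⟨$⟩ˡ (π̂ ⟨$⟩ʳ x)))
    ≡⟨ cong (c ⟨$⟩ʳ_) (lift₀-⁻¹ π _) ⟩
  (c ⊙ π̂ ⁻¹ ⊙ c ⁻¹ ⊙ π̂) ⟨$⟩ʳ x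
    ≡⟨ sym (conjugate-commutator-⁻¹ c π̂ x) ⟩
  (π̂ ⁻¹ ⊙ bar π ⁻¹ ⊙ π̂) ⟨$⟩ʳ x ∎
  where
  open ≡-Reasoning
  c π̂ : Permutation′ (ℕ.suc n)
  c  = cycle0n
  π̂ = lift₀ π
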